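{- For every integer $n\ge2$, as polynomials in $t$, $$(t-1)^{n-2}=\sum_{\substack{\gamma=(\gamma_1,\dots,\gamma_\ell)\vDash n\\ \ell\ge2}}(-1)^{n-\ell}(\gamma_2t+1)\cdots(\gamma_{\ell-1}t+1),$$ the sum running over integer compositions $\gamma$ of $n$ with at least two parts (empty product equal to $1$).
   Context: An integer composition $\gamma\vDash n$ is a sequence $(\gamma_1,\dots,\gamma_\ell)$ of positive integers with sum $n$; $\ell=\ell(\gamma)$ is its number of parts. -}

module Defs where

open import Data.Nat as ℕ using (ℕ; zero; suc)
open import Data.Integer as ℤ using (ℤ; +_; -_)
open import Data.List using (List; []; _∷_; _++_; map; foldr; length; filter)
open import Data.Nat.ListAction using (sum)
open import Data.List.Membership.Propositional using (_∈_)
open import Data.List.Relation.Unary.Unique.Propositional using (Unique)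
open import Function.Bundles using (_⇔_)
open import Data.List.Relation.Unary.All using (All)
open import Data.Product using (_×_)
open import Relation.Binary.PropositionalEquality using (_≡_)

-- Polynomials in t with integer coefficients, as coefficient lists
-- (constant term first).

Poly : Set
Poly = List ℤ

_+P_ : Poly → Poly → Poly
[]       +P q        = q
(a ∷ p)  +P []       = a ∷ p
(a ∷ p)  +P (b ∷ q)  = (a ℤ.+ b) ∷ (p +P q)

scaleP : ℤ → Poly → Poly
scaleP c = map (c ℤ.*_)

_*P_ : Poly → Poly → Poly
[]      *P q = []
(a ∷ p) *P q = scaleP a q +P (+ 0 ∷ (p *P q))

constP : ℤ → Poly
constP c = c ∷ []

oneP : Poly
oneP = constP (+ 1)

tMinus1 : Poly
tMinus1 = - (+ 1) ∷ + 1 ∷ []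

_^P_ : Poly → ℕ → Poly
p ^P zero    = oneP
p ^P suc k   = p *P (p ^P k)

linP : ℕ → Poly
linP g = + 1 ∷ + g ∷ []

sumP : List Poly → Poly
sumP = foldr _+P_ []

prodP : List Poly → Poly
prodP = foldr _*P_ oneP

coeff : Poly → ℕ → ℤ
coeff []      _       = + 0
coeff (a ∷ p) zero    = a
coeff (a ∷ p) (suc i) = coeff p i

_≈P_ : Poly → Poly → Set
p ≈P q = ∀ i → coeff p i ≡ coeff q i

IsComposition : ℕ → List ℕ → Set
IsComposition n γ = All (λ g → 1 ℕ.≤ g) γ × sum γ ≡ n

EnumeratesCompositions : ℕ → List (List ℕ) → Set
EnumeratesCompositions n cs = Unique cs × (∀ γ → (γ ∈ cs) ⇔ IsComposition n γ)

-- Inner parts γ₂,…,γ_{ℓ-1} of a composition (empty if ℓ ≤ 2).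
dropLast : List ℕ → List ℕ
dropLast []          = []
dropLast (x ∷ [])    = []
dropLast (x ∷ y ∷ γ) = x ∷ dropLast (y ∷ γ)

inner : List ℕ → List ℕ
inner []      = []
inner (_ ∷ γ) = dropLast γ

sign : ℕ → ℤ
sign zero    = + 1
sign (suc k) = - sign k

term : ℕ → List ℕ → Poly
term n γ = scaleP (sign (n ℕ.∸ length γ)) (prodP (map linP (inner γ)))

rhs : ℕ → List (List ℕ) → Poly
rhs n cs = sumP (map (term n) (filter (λ γ → 2 ℕ.≤? length γ) cs))

-- Every composition of n + 1 arises exactly once from a composition γ of n, either by
-- prepending a part 1 or by increasing the first part γ₁. Prepending turns γ₁ into an inner
-- part, multiplying the summand by (γ₁ t + 1) with the same sign, and turns the one-part
-- composition (n) into a new constant summand (-1)^(n-1); increasing γ₁ only flips the sign.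
-- So if T(n) is the right-hand side and W(n) the same sum with each summand weighted by γ₁,
-- then T(n+1) = t W(n) + (-1)^(n-1) and W(n+1) = (t - 1) W(n) + (-1)^(n-1). Eliminating W
-- gives T(n+2) = (t - 1) T(n+1), and T(2) = 1.
module Submission where

open import Defs
open import Data.Nat using (ℕ; _≤_; _∸_)
open import Data.List using (List)

open import Algebra.Structures using (IsCommutativeMonoid)
open import Algebra.Structures.Biased using (isCommutativeMonoidˡ)
open import Data.Integer using (ℤ; +_; -_; _+_; _*_)
import Data.Integer.Properties as ℤ
open import Data.Integer.Tactic.RingSolver using (solve-∀)
open import Data.List using ([]; _∷_; _++_; map; length)
open import Data.List.Properties using (map-++; map-∘)
open import Data.List.Membership.Propositional using (_∈_)
open import Data.List.Membership.Propositional.Properties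
  using (∈-map⁺; ∈-map⁻; ∈-++⁺ˡ; ∈-++⁺ʳ; ∈-++⁻)
open import Data.List.Membership.Propositional.Properties.WithK using (unique∧set⇒bag)
open import Data.List.Relation.Binary.BagAndSetEquality using (∼bag⇒↭)
open import Data.List.Relation.Binary.Permutation.Propositional using (_↭_; ↭⇒↭ₛ)
open import Data.List.Relation.Binary.Permutation.Propositional.Properties
  using (map⁺; filter-↭)
open import Data.List.Relation.Binary.Permutation.Setoid.Properties using (foldr-commMonoid)
open import Data.List.Relation.Unary.All using (All; []; _∷_)
open import Data.List.Relation.Unary.Any using (here; there)
open import Data.List.Relation.Unary.AllPairs using ([]; _∷_)
open import Data.List.Relation.Unary.Unique.Propositional using (Unique)
import Data.List.Relation.Unary.Unique.Propositional.Properties as Unique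
open import Data.Nat using (zero; suc; z≤n; s≤s)
import Data.Nat.Properties as ℕ
open import Data.Nat.ListAction using (sum)
open import Data.Product using (_×_; _,_; proj₂)
open import Data.Sum using (inj₁; inj₂)
open import Function using (_∘_)
open import Function.Bundles using (Equivalence; mk⇔)
open import Relation.Binary.Bundles using (Setoid)
open import Relation.Binary.PropositionalEquality
  using (_≡_; _≢_; refl; sym; trans; cong; cong₂; setoid; module ≡-Reasoning)
open import Relation.Binary.PropositionalEquality.Algebra using (isMagma)
import Relation.Binary.Reasoning.Setoid as SetoidReasoning
open import Relation.Nullary using (¬_)

-- Polynomial arithmetic

negP : Poly → Poly
negP = scaleP (- + 1)

shiftP : Poly → Poly
shiftP p = + 0 ∷ p

coeff-+P : ∀ p q i → coeff (p +P q) i ≡ coeff p i + coeff q i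
coeff-+P []      q       i       = sym (ℤ.+-identityˡ (coeff q i))
coeff-+P (a ∷ p) []      i       = sym (ℤ.+-identityʳ (coeff (a ∷ p) i))
coeff-+P (a ∷ p) (b ∷ q) zero    = refl
coeff-+P (a ∷ p) (b ∷ q) (suc i) = coeff-+P p q i

coeff-scaleP : ∀ c p i → coeff (scaleP c p) i ≡ c * coeff p i
coeff-scaleP c []      i       = sym (ℤ.*-zeroʳ c)
coeff-scaleP c (a ∷ p) zero    = refl
coeff-scaleP c (a ∷ p) (suc i) = coeff-scaleP c p i

-- _≈P_ unfolds to a Π-type, from which Agda cannot infer the polynomials involved;
-- _≃_ is the same relation wrapped in a record, whose indices are inferable.
record _≃_ (p q : Poly) : Set where
  constructor coeffwise
  field coeff-≡ : p ≈P q

infix 4 _≃_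

≃-setoid : Setoid _ _
≃-setoid = record
  { Carrier       = Poly
  ; _≈_           = _≃_
  ; isEquivalence = record
    { refl  = coeffwise λ _ → refl
    ; sym   = λ (coeffwise p≈q) → coeffwise λ i → sym (p≈q i)
    ; trans = λ (coeffwise p≈q) (coeffwise q≈r) → coeffwise λ i → trans (p≈q i) (q≈r i)
    }
  }

open Setoid ≃-setoid using ()
  renaming (refl to ≃-refl; sym to ≃-sym; trans to ≃-trans; reflexive to ≡⇒≃)

+P-cong : ∀ {p p′ q q′} → p ≃ p′ → q ≃ q′ → p +P q ≃ p′ +P q′
+P-cong {p} {p′} {q} {q′} (coeffwise p≈p′) (coeffwise q≈q′) = coeffwise λ i → begin
  coeff (p +P q) i        ≡⟨ coeff-+P p q i ⟩
  coeff p i + coeff q i   ≡⟨ cong₂ _+_ (p≈p′ i) (q≈q′ i) ⟩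
  coeff p′ i + coeff q′ i ≡⟨ coeff-+P p′ q′ i ⟨
  coeff (p′ +P q′) i      ∎
  where open ≡-Reasoning

scaleP-cong : ∀ c {p q} → p ≃ q → scaleP c p ≃ scaleP c q
scaleP-cong c {p} {q} (coeffwise p≈q) = coeffwise λ i →
  trans (coeff-scaleP c p i) (trans (cong (c *_) (p≈q i)) (sym (coeff-scaleP c q i)))

shiftP-cong : ∀ {p q} → p ≃ q → shiftP p ≃ shiftP q
shiftP-cong (coeffwise p≈q) = coeffwise λ where
  zero    → refl
  (suc i) → p≈q i

*P-congˡ : ∀ p {q q′} → q ≃ q′ → p *P q ≃ p *P q′
*P-congˡ []      q≃q′ = ≃-refl
*P-congˡ (a ∷ p) q≃q′ = +P-cong (scaleP-cong a q≃q′) (shiftP-cong (*P-congˡ p q≃q′))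

+P-identityʳ : ∀ p → p +P [] ≡ p
+P-identityʳ []      = refl
+P-identityʳ (a ∷ p) = refl

+P-zeroʳ : ∀ p → p +P constP (+ 0) ≃ p
+P-zeroʳ []      = coeffwise λ where
  zero    → refl
  (suc i) → refl
+P-zeroʳ (a ∷ p) = coeffwise λ where
  zero    → ℤ.+-identityʳ a
  (suc i) → cong (λ r → coeff r i) (+P-identityʳ p)

+P-assoc : ∀ p q r → (p +P q) +P r ≡ p +P (q +P r)
+P-assoc []      q       r       = refl
+P-assoc (a ∷ p) []      r       = refl
+P-assoc (a ∷ p) (b ∷ q) []      = refl
+P-assoc (a ∷ p) (b ∷ q) (c ∷ r) = cong₂ _∷_ (ℤ.+-assoc a b c) (+P-assoc p q r)

+P-comm : ∀ p q → p +P q ≡ q +P p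
+P-comm []      []      = refl
+P-comm []      (b ∷ q) = refl
+P-comm (a ∷ p) []      = refl
+P-comm (a ∷ p) (b ∷ q) = cong₂ _∷_ (ℤ.+-comm a b) (+P-comm p q)

+P-interchange : ∀ p q r s → (p +P q) +P (r +P s) ≡ (p +P r) +P (q +P s)
+P-interchange p q r s = begin
  (p +P q) +P (r +P s) ≡⟨ +P-assoc p q (r +P s) ⟩
  p +P (q +P (r +P s)) ≡⟨ cong (p +P_) (+P-assoc q r s) ⟨
  p +P ((q +P r) +P s) ≡⟨ cong (λ x → p +P (x +P s)) (+P-comm q r) ⟩
  p +P ((r +P q) +P s) ≡⟨ cong (p +P_) (+P-assoc r q s) ⟩
  p +P (r +P (q +P s)) ≡⟨ +P-assoc p r (q +P s) ⟨
  (p +P r) +P (q +P s) ∎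
  where open ≡-Reasoning

scaleP-one : ∀ p → scaleP (+ 1) p ≡ p
scaleP-one []      = refl
scaleP-one (a ∷ p) = cong₂ _∷_ (ℤ.*-identityˡ a) (scaleP-one p)

scaleP-scaleP : ∀ a b p → scaleP a (scaleP b p) ≡ scaleP (a * b) p
scaleP-scaleP a b []      = refl
scaleP-scaleP a b (c ∷ p) = cong₂ _∷_ (sym (ℤ.*-assoc a b c)) (scaleP-scaleP a b p)

scaleP-comm : ∀ a b p → scaleP a (scaleP b p) ≡ scaleP b (scaleP a p)
scaleP-comm a b p = begin
  scaleP a (scaleP b p) ≡⟨ scaleP-scaleP a b p ⟩
  scaleP (a * b) p      ≡⟨ cong (λ c → scaleP c p) (ℤ.*-comm a b) ⟩
  scaleP (b * a) p      ≡⟨ scaleP-scaleP b a p ⟨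
  scaleP b (scaleP a p) ∎
  where open ≡-Reasoning

scaleP-distrib-+P : ∀ c p q → scaleP c (p +P q) ≡ scaleP c p +P scaleP c q
scaleP-distrib-+P c []      q       = refl
scaleP-distrib-+P c (a ∷ p) []      = refl
scaleP-distrib-+P c (a ∷ p) (b ∷ q) =
  cong₂ _∷_ (ℤ.*-distribˡ-+ c a b) (scaleP-distrib-+P c p q)

scaleP-shiftP : ∀ c p → scaleP c (shiftP p) ≃ shiftP (scaleP c p)
scaleP-shiftP c p = coeffwise λ where
  zero    → ℤ.*-zeroʳ c
  (suc i) → refl

*P-linear : ∀ a b q → (a ∷ b ∷ []) *P q ≃ scaleP a q +P shiftP (scaleP b q)
*P-linear a b q = +P-cong ≃-refl (shiftP-cong (+P-zeroʳ (scaleP b q)))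

linP-*P : ∀ g q → linP g *P q ≃ q +P shiftP (scaleP (+ g) q)
linP-*P g q = ≃-trans (*P-linear (+ 1) (+ g) q)
  (≡⇒≃ (cong (_+P shiftP (scaleP (+ g) q)) (scaleP-one q)))

tMinus1-*P : ∀ q → tMinus1 *P q ≃ negP q +P shiftP q
tMinus1-*P q = ≃-trans (*P-linear (- + 1) (+ 1) q)
  (≡⇒≃ (cong (λ r → negP q +P shiftP r) (scaleP-one q)))

scaleP-*P : ∀ c p q → scaleP c (p *P q) ≃ p *P scaleP c q
scaleP-*P c []      q = ≃-refl
scaleP-*P c (a ∷ p) q = begin
  scaleP c (scaleP a q +P shiftP (p *P q))
    ≡⟨ scaleP-distrib-+P c (scaleP a q) (shiftP (p *P q)) ⟩
  scaleP c (scaleP a q) +P scaleP c (shiftP (p *P q))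
    ≈⟨ +P-cong (≡⇒≃ (scaleP-comm c a q)) (scaleP-shiftP c (p *P q)) ⟩
  scaleP a (scaleP c q) +P shiftP (scaleP c (p *P q))
    ≈⟨ +P-cong ≃-refl (shiftP-cong (scaleP-*P c p q)) ⟩
  scaleP a (scaleP c q) +P shiftP (p *P scaleP c q) ∎
  where open SetoidReasoning ≃-setoid

shiftP-*P : ∀ p q → shiftP (p *P q) ≃ p *P shiftP q
shiftP-*P []      q = coeffwise λ where
  zero    → refl
  (suc i) → refl
shiftP-*P (a ∷ p) q =
  +P-cong (≃-sym (scaleP-shiftP a q)) (shiftP-cong (shiftP-*P p q))

*P-distribˡ-+P : ∀ p q r → p *P (q +P r) ≃ (p *P q) +P (p *P r)
*P-distribˡ-+P []      q r = ≃-refl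
*P-distribˡ-+P (a ∷ p) q r = begin
  scaleP a (q +P r) +P shiftP (p *P (q +P r))
    ≈⟨ +P-cong (≡⇒≃ (scaleP-distrib-+P a q r)) (shiftP-cong (*P-distribˡ-+P p q r)) ⟩
  (scaleP a q +P scaleP a r) +P (shiftP (p *P q) +P shiftP (p *P r))
    ≡⟨ +P-interchange (scaleP a q) (scaleP a r) (shiftP (p *P q)) (shiftP (p *P r)) ⟩
  (scaleP a q +P shiftP (p *P q)) +P (scaleP a r +P shiftP (p *P r)) ∎
  where open SetoidReasoning ≃-setoid

scaleP-suc-negP : ∀ g p → scaleP (+ suc g) (negP p) ≃ negP (p +P scaleP (+ g) p)
scaleP-suc-negP g p = coeffwise coeffs
  where
  coeffs : ∀ i → coeff (scaleP (+ suc g) (negP p)) i ≡ coeff (negP (p +P scaleP (+ g) p)) i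
  coeffs i rewrite coeff-scaleP (+ suc g) (negP p) i | coeff-scaleP (- + 1) p i
                 | coeff-scaleP (- + 1) (p +P scaleP (+ g) p) i | coeff-+P p (scaleP (+ g) p) i
                 | coeff-scaleP (+ g) p i
    = identity (+ g) (coeff p i)
    where
    identity : ∀ g a → (+ 1 + g) * (- + 1 * a) ≡ - + 1 * (a + g * a)
    identity = solve-∀

+P-negP-cancel : ∀ p q r → ((p +P q) +P r) +P negP p ≃ q +P r
+P-negP-cancel p q r = coeffwise coeffs
  where
  coeffs : ∀ i → coeff (((p +P q) +P r) +P negP p) i ≡ coeff (q +P r) i
  coeffs i rewrite coeff-+P ((p +P q) +P r) (negP p) i | coeff-+P (p +P q) r i | coeff-+P p q i
                 | coeff-scaleP (- + 1) p i | coeff-+P q r i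
    = identity (coeff p i) (coeff q i) (coeff r i)
    where
    identity : ∀ a b c → ((a + b) + c) + - + 1 * a ≡ b + c
    identity = solve-∀

+P-negP-cancel-+P : ∀ p q r s → ((p +P q) +P r) +P negP (p +P s) ≃ (negP s +P q) +P r
+P-negP-cancel-+P p q r s = coeffwise coeffs
  where
  coeffs : ∀ i → coeff (((p +P q) +P r) +P negP (p +P s)) i ≡ coeff ((negP s +P q) +P r) i
  coeffs i rewrite coeff-+P ((p +P q) +P r) (negP (p +P s)) i | coeff-+P (p +P q) r i
                 | coeff-+P p q i | coeff-scaleP (- + 1) (p +P s) i | coeff-+P p s i
                 | coeff-+P (negP s +P q) r i | coeff-+P (negP s) q i | coeff-scaleP (- + 1) s i
    = identity (coeff p i) (coeff q i) (coeff r i) (coeff s i)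
    where
    identity : ∀ a b c d → ((a + b) + c) + - + 1 * (a + d) ≡ (- + 1 * d + b) + c
    identity = solve-∀

shiftP-constP-+P-constP : ∀ c → shiftP (constP c) +P constP (- c) ≃ tMinus1 *P constP c
shiftP-constP-+P-constP c = begin
  shiftP (constP c) +P constP (- c)
    ≡⟨ +P-comm (shiftP (constP c)) (constP (- c)) ⟩
  constP (- c) +P shiftP (constP c)
    ≈⟨ +P-cong (≡⇒≃ (cong constP (sym (ℤ.-1*i≡-i c)))) (≃-refl {shiftP (constP c)}) ⟩
  negP (constP c) +P shiftP (constP c)
    ≈⟨ tMinus1-*P (constP c) ⟨
  tMinus1 *P constP c ∎
  where open SetoidReasoning ≃-setoid

+P-isCommutativeMonoid : IsCommutativeMonoid _≡_ _+P_ []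
+P-isCommutativeMonoid = isCommutativeMonoidˡ record
  { isSemigroup = record { isMagma = isMagma _+P_ ; assoc = +P-assoc }
  ; identityˡ   = λ _ → refl
  ; comm        = +P-comm
  }

sumP-↭ : ∀ {ps qs} → ps ↭ qs → sumP ps ≡ sumP qs
sumP-↭ ps↭qs = foldr-commMonoid (setoid Poly) +P-isCommutativeMonoid (↭⇒↭ₛ ps↭qs)

sumP-++ : ∀ ps qs → sumP (ps ++ qs) ≡ sumP ps +P sumP qs
sumP-++ []       qs = refl
sumP-++ (p ∷ ps) qs = trans (cong (p +P_) (sumP-++ ps qs)) (sym (+P-assoc p (sumP ps) (sumP qs)))

module _ {A : Set} where

  sumP-map-+P : ∀ (f g : A → Poly) xs →
    sumP (map (λ x → f x +P g x) xs) ≡ sumP (map f xs) +P sumP (map g xs)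
  sumP-map-+P f g []       = refl
  sumP-map-+P f g (x ∷ xs) =
    trans (cong (_ +P_) (sumP-map-+P f g xs)) (+P-interchange (f x) (g x) _ _)

  sumP-map-scaleP : ∀ c (f : A → Poly) xs →
    sumP (map (λ x → scaleP c (f x)) xs) ≡ scaleP c (sumP (map f xs))
  sumP-map-scaleP c f []       = refl
  sumP-map-scaleP c f (x ∷ xs) =
    trans (cong (_ +P_) (sumP-map-scaleP c f xs)) (sym (scaleP-distrib-+P c (f x) _))

  sumP-map-shiftP : ∀ (f : A → Poly) xs →
    sumP (map (λ x → shiftP (f x)) xs) ≃ shiftP (sumP (map f xs))
  sumP-map-shiftP f []       = coeffwise λ where
    zero    → refl
    (suc i) → refl
  sumP-map-shiftP f (x ∷ xs) = +P-cong ≃-refl (sumP-map-shiftP f xs)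

  sumP-map-zero : ∀ (xs : List A) → sumP (map (λ _ → []) xs) ≡ []
  sumP-map-zero []       = refl
  sumP-map-zero (x ∷ xs) = sumP-map-zero xs

  sumP-map-cong : ∀ {f g : A → Poly} xs → (∀ {x} → x ∈ xs → f x ≃ g x) →
    sumP (map f xs) ≃ sumP (map g xs)
  sumP-map-cong []       f≃g = ≃-refl
  sumP-map-cong (x ∷ xs) f≃g = +P-cong (f≃g (here refl)) (sumP-map-cong xs (f≃g ∘ there))

-- Compositions

IsComposition⇒length≤ : ∀ {n} γ → IsComposition n γ → length γ ≤ n
IsComposition⇒length≤ γ (positive , refl) = length≤sum γ positive
  where
  length≤sum : ∀ γ → All (1 ≤_) γ → length γ ≤ sum γ
  length≤sum []      []               = z≤n
  length≤sum (g ∷ γ) (1≤g ∷ positive) = ℕ.+-mono-≤ 1≤g (length≤sum γ positive)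

incrementHead : List ℕ → List ℕ
incrementHead []      = []
incrementHead (g ∷ γ) = suc g ∷ γ

-- compositions⁺ m lists the compositions of 1 + m.
compositions⁺ : ℕ → List (List ℕ)
compositions⁺ zero    = (1 ∷ []) ∷ []
compositions⁺ (suc m) = map (1 ∷_) (compositions⁺ m) ++ map incrementHead (compositions⁺ m)

prepend-IsComposition : ∀ {n γ} → IsComposition n γ → IsComposition (suc n) (1 ∷ γ)
prepend-IsComposition (positive , refl) = s≤s z≤n ∷ positive , refl

incrementHead-IsComposition : ∀ {n γ} → IsComposition (suc n) γ →
  IsComposition (suc (suc n)) (incrementHead γ)
incrementHead-IsComposition {γ = []}    (_ , ())
incrementHead-IsComposition {γ = g ∷ γ} (_ ∷ positive , sum≡) =
  s≤s z≤n ∷ positive , cong suc sum≡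

compositions⁺-sound : ∀ m {γ} → γ ∈ compositions⁺ m → IsComposition (suc m) γ
compositions⁺-sound zero    (here refl) = s≤s z≤n ∷ [] , refl
compositions⁺-sound (suc m) γ∈ with ∈-++⁻ (map (1 ∷_) (compositions⁺ m)) γ∈
... | inj₁ γ∈prepended with δ , δ∈ , refl ← ∈-map⁻ (1 ∷_) γ∈prepended =
  prepend-IsComposition (compositions⁺-sound m δ∈)
... | inj₂ γ∈incremented with δ , δ∈ , refl ← ∈-map⁻ incrementHead γ∈incremented =
  incrementHead-IsComposition (compositions⁺-sound m δ∈)

compositions⁺-complete : ∀ m γ → IsComposition (suc m) γ → γ ∈ compositions⁺ m
compositions⁺-complete m       []                (_ , ())
compositions⁺-complete m       (0 ∷ γ)           (() ∷ _ , _)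
compositions⁺-complete zero    (1 ∷ [])          _ = here refl
compositions⁺-complete zero    (1 ∷ 0 ∷ γ)       (_ ∷ () ∷ _ , _)
compositions⁺-complete zero    (1 ∷ suc g ∷ γ)   (_ , ())
compositions⁺-complete zero    (suc (suc g) ∷ γ) (_ , ())
compositions⁺-complete (suc m) (1 ∷ γ)           (_ ∷ positive , sum≡) =
  ∈-++⁺ˡ (∈-map⁺ (1 ∷_) (compositions⁺-complete m γ (positive , ℕ.suc-injective sum≡)))
compositions⁺-complete (suc m) (suc (suc g) ∷ γ) (_ ∷ positive , sum≡) =
  ∈-++⁺ʳ (map (1 ∷_) (compositions⁺ m))
    (∈-map⁺ incrementHead
      (compositions⁺-complete m (suc g ∷ γ) (s≤s z≤n ∷ positive , ℕ.suc-injective sum≡)))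

incrementHead-injective : ∀ {γ δ} → incrementHead γ ≡ incrementHead δ → γ ≡ δ
incrementHead-injective {[]}    {[]}    _    = refl
incrementHead-injective {g ∷ γ} {h ∷ δ} refl = refl

positive⇒1∷≢incrementHead : ∀ {n γ δ} → IsComposition n δ → 1 ∷ γ ≢ incrementHead δ
positive⇒1∷≢incrementHead {δ = []}        _              ()
positive⇒1∷≢incrementHead {δ = 0 ∷ _}     (() ∷ _ , _) _
positive⇒1∷≢incrementHead {δ = suc _ ∷ _} _              ()

compositions⁺-unique : ∀ m → Unique (compositions⁺ m)
compositions⁺-unique zero    = [] ∷ []
compositions⁺-unique (suc m) =
  Unique.++⁺ (Unique.map⁺ ∷-injectiveʳ (compositions⁺-unique m))
             (Unique.map⁺ incrementHead-injective (compositions⁺-unique m))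
             disjoint
  where
  ∷-injectiveʳ : ∀ {γ δ : List ℕ} → 1 ∷ γ ≡ 1 ∷ δ → γ ≡ δ
  ∷-injectiveʳ refl = refl

  disjoint : ∀ {γ} →
    ¬ (γ ∈ map (1 ∷_) (compositions⁺ m) × γ ∈ map incrementHead (compositions⁺ m))
  disjoint (γ∈prepended , γ∈incremented)
    with _ , _ , refl ← ∈-map⁻ (1 ∷_) γ∈prepended
       | δ , δ∈ , 1∷≡ ← ∈-map⁻ incrementHead γ∈incremented
    = positive⇒1∷≢incrementHead (compositions⁺-sound m δ∈) 1∷≡

compositions⁺-enumerates : ∀ m → EnumeratesCompositions (suc m) (compositions⁺ m)
compositions⁺-enumerates m =
  compositions⁺-unique m , λ γ → mk⇔ (compositions⁺-sound m) (compositions⁺-complete m γ)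

enumerations-↭ : ∀ {n cs ds} →
  EnumeratesCompositions n cs → EnumeratesCompositions n ds → cs ↭ ds
enumerations-↭ (cs-unique , ∈cs⇔) (ds-unique , ∈ds⇔) =
  ∼bag⇒↭ (unique∧set⇒bag cs-unique ds-unique λ {γ} →
    mk⇔ (Equivalence.from (∈ds⇔ γ) ∘ Equivalence.to (∈cs⇔ γ))
        (Equivalence.from (∈cs⇔ γ) ∘ Equivalence.to (∈ds⇔ γ)))

rhs-↭ : ∀ n {cs ds} → cs ↭ ds → rhs n cs ≡ rhs n ds
rhs-↭ n cs↭ds = sumP-↭ (map⁺ (term n) (filter-↭ (λ γ → 2 ℕ.≤? length γ) cs↭ds))

summand : ℕ → List ℕ → Poly
summand n γ@(_ ∷ _ ∷ _) = term n γ
summand n _             = []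

rhs≡sumP-map-summand : ∀ n cs → rhs n cs ≡ sumP (map (summand n) cs)
rhs≡sumP-map-summand n []                   = refl
rhs≡sumP-map-summand n ([] ∷ cs)            = rhs≡sumP-map-summand n cs
rhs≡sumP-map-summand n ((_ ∷ []) ∷ cs)      = rhs≡sumP-map-summand n cs
rhs≡sumP-map-summand n (γ@(_ ∷ _ ∷ _) ∷ cs) = cong (term n γ +P_) (rhs≡sumP-map-summand n cs)

firstPart : List ℕ → ℕ
firstPart []      = 0
firstPart (g ∷ _) = g

weightedSummand : ℕ → List ℕ → Poly
weightedSummand n γ = scaleP (+ firstPart γ) (summand n γ)

onePart : ℤ → List ℕ → Poly
onePart s (_ ∷ []) = constP s
onePart s _        = []

summand-prepend : ∀ n γ →
  summand (suc n) (1 ∷ γ) ≃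
    (summand n γ +P shiftP (weightedSummand n γ)) +P onePart (sign (n ∸ 1)) γ
summand-prepend n []          = coeffwise λ where
  zero    → refl
  (suc i) → refl
summand-prepend n (g ∷ [])    = coeffwise λ where
  zero    → trans (ℤ.*-identityʳ (sign (n ∸ 1))) (sym (ℤ.+-identityˡ (sign (n ∸ 1))))
  (suc i) → refl
summand-prepend n (g ∷ y ∷ γ) = begin
  scaleP s (linP g *P Q)                                    ≈⟨ scaleP-*P s (linP g) Q ⟩
  linP g *P scaleP s Q                                      ≈⟨ linP-*P g (scaleP s Q) ⟩
  scaleP s Q +P shiftP (scaleP (+ g) (scaleP s Q))          ≡⟨ +P-identityʳ _ ⟨
  (scaleP s Q +P shiftP (scaleP (+ g) (scaleP s Q))) +P [] ∎
  where
  open SetoidReasoning ≃-setoid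
  s = sign (n ∸ length (g ∷ y ∷ γ))
  Q = prodP (map linP (inner (g ∷ y ∷ γ)))

-- Without ℓ ≤ n the truncated n ∸ ℓ would be 0 on both sides and the sign would not flip.
summand-incrementHead : ∀ n γ → length γ ≤ n →
  summand (suc n) (incrementHead γ) ≡ negP (summand n γ)
summand-incrementHead n []          _   = refl
summand-incrementHead n (g ∷ [])    _   = refl
summand-incrementHead n (g ∷ y ∷ γ) ℓ≤n = begin
  scaleP (sign (suc n ∸ ℓ)) Q ≡⟨ cong (λ k → scaleP (sign k) Q) (ℕ.+-∸-assoc 1 ℓ≤n) ⟩
  scaleP (- s) Q              ≡⟨ cong (λ c → scaleP c Q) (ℤ.-1*i≡-i s) ⟨
  scaleP (- + 1 * s) Q        ≡⟨ scaleP-scaleP (- + 1) s Q ⟨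
  negP (scaleP s Q)           ∎
  where
  open ≡-Reasoning
  ℓ = length (g ∷ y ∷ γ)
  s = sign (n ∸ ℓ)
  Q = prodP (map linP (inner (g ∷ y ∷ γ)))

weightedSummand-incrementHead : ∀ n γ → length γ ≤ n →
  weightedSummand (suc n) (incrementHead γ) ≃ negP (summand n γ +P weightedSummand n γ)
weightedSummand-incrementHead n []      _   = ≃-refl
weightedSummand-incrementHead n (g ∷ γ) ℓ≤n = ≃-trans
  (≡⇒≃ (cong (scaleP (+ suc g)) (summand-incrementHead n (g ∷ γ) ℓ≤n)))
  (scaleP-suc-negP g (summand n (g ∷ γ)))

onePart-incrementHead : ∀ s γ → onePart s (incrementHead γ) ≡ onePart s γ
onePart-incrementHead s []          = refl
onePart-incrementHead s (g ∷ [])    = refl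
onePart-incrementHead s (g ∷ y ∷ γ) = refl

-- The recursion

sumP-map-compositions⁺-suc : ∀ (f : List ℕ → Poly) m →
  sumP (map f (compositions⁺ (suc m))) ≡
    sumP (map (f ∘ (1 ∷_)) (compositions⁺ m)) +P sumP (map (f ∘ incrementHead) (compositions⁺ m))
sumP-map-compositions⁺-suc f m = begin
  sumP (map f (map (1 ∷_) Γ ++ map incrementHead Γ))
    ≡⟨ cong sumP (map-++ f (map (1 ∷_) Γ) (map incrementHead Γ)) ⟩
  sumP (map f (map (1 ∷_) Γ) ++ map f (map incrementHead Γ))
    ≡⟨ sumP-++ (map f (map (1 ∷_) Γ)) (map f (map incrementHead Γ)) ⟩
  sumP (map f (map (1 ∷_) Γ)) +P sumP (map f (map incrementHead Γ))
    ≡⟨ cong₂ (λ ps qs → sumP ps +P sumP qs) (map-∘ Γ) (map-∘ Γ) ⟨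
  sumP (map (f ∘ (1 ∷_)) Γ) +P sumP (map (f ∘ incrementHead) Γ) ∎
  where
  open ≡-Reasoning
  Γ = compositions⁺ m

sumP-map-onePart : ∀ s m → sumP (map (onePart s) (compositions⁺ m)) ≃ constP s
sumP-map-onePart s zero    = ≃-refl
sumP-map-onePart s (suc m) = begin
  sumP (map (onePart s) (compositions⁺ (suc m)))
    ≡⟨ sumP-map-compositions⁺-suc (onePart s) m ⟩
  sumP (map (onePart s ∘ (1 ∷_)) Γ) +P sumP (map (onePart s ∘ incrementHead) Γ)
    ≈⟨ +P-cong (sumP-map-cong Γ prepended-onePart)
               (sumP-map-cong Γ λ {γ} _ → ≡⇒≃ (onePart-incrementHead s γ)) ⟩
  sumP (map (λ _ → []) Γ) +P sumP (map (onePart s) Γ)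
    ≡⟨ cong (_+P sumP (map (onePart s) Γ)) (sumP-map-zero Γ) ⟩
  sumP (map (onePart s) Γ)
    ≈⟨ sumP-map-onePart s m ⟩
  constP s ∎
  where
  open SetoidReasoning ≃-setoid
  Γ = compositions⁺ m
  prepended-onePart : ∀ {γ} → γ ∈ Γ → onePart s (1 ∷ γ) ≃ []
  prepended-onePart {[]}    γ∈ with () ← proj₂ (compositions⁺-sound m γ∈)
  prepended-onePart {_ ∷ _} _ = ≃-refl

-- T(1 + m) and W(1 + m) of the proof idea.
total : ℕ → Poly
total m = sumP (map (summand (suc m)) (compositions⁺ m))

weighted : ℕ → Poly
weighted m = sumP (map (weightedSummand (suc m)) (compositions⁺ m))

module _ (m : ℕ) where

  private
    Γ = compositions⁺ m
    T = total m
    W = weighted m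
    c = constP (sign m)

    length≤ : ∀ {γ} → γ ∈ Γ → length γ ≤ suc m
    length≤ {γ} γ∈ = IsComposition⇒length≤ γ (compositions⁺-sound m γ∈)

  sumP-prepended : sumP (map (summand (suc (suc m)) ∘ (1 ∷_)) Γ) ≃ (T +P shiftP W) +P c
  sumP-prepended = begin
    sumP (map (summand (suc (suc m)) ∘ (1 ∷_)) Γ)
      ≈⟨ sumP-map-cong Γ (λ {γ} _ → summand-prepend (suc m) γ) ⟩
    sumP (map (λ γ → (summand (suc m) γ +P shiftP (w γ)) +P onePart (sign m) γ) Γ)
      ≡⟨ sumP-map-+P _ (onePart (sign m)) Γ ⟩
    sumP (map (λ γ → summand (suc m) γ +P shiftP (w γ)) Γ) +P ones
      ≡⟨ cong (_+P ones) (sumP-map-+P (summand (suc m)) (shiftP ∘ w) Γ) ⟩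
    (T +P sumP (map (shiftP ∘ w) Γ)) +P ones
      ≈⟨ +P-cong (+P-cong ≃-refl (sumP-map-shiftP w Γ)) (sumP-map-onePart (sign m) m) ⟩
    (T +P shiftP W) +P c ∎
    where
    open SetoidReasoning ≃-setoid
    w = weightedSummand (suc m)
    ones = sumP (map (onePart (sign m)) Γ)

  sumP-incremented : sumP (map (summand (suc (suc m)) ∘ incrementHead) Γ) ≃ negP T
  sumP-incremented = ≃-trans
    (sumP-map-cong Γ λ {γ} γ∈ → ≡⇒≃ (summand-incrementHead (suc m) γ (length≤ γ∈)))
    (≡⇒≃ (sumP-map-scaleP (- + 1) (summand (suc m)) Γ))

  sumP-incremented-weighted :
    sumP (map (weightedSummand (suc (suc m)) ∘ incrementHead) Γ) ≃ negP (T +P W)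
  sumP-incremented-weighted = begin
    sumP (map (weightedSummand (suc (suc m)) ∘ incrementHead) Γ)
      ≈⟨ sumP-map-cong Γ (λ {γ} γ∈ → weightedSummand-incrementHead (suc m) γ (length≤ γ∈)) ⟩
    sumP (map (λ γ → negP (summand (suc m) γ +P weightedSummand (suc m) γ)) Γ)
      ≡⟨ sumP-map-scaleP (- + 1) _ Γ ⟩
    negP (sumP (map (λ γ → summand (suc m) γ +P weightedSummand (suc m) γ) Γ))
      ≡⟨ cong negP (sumP-map-+P (summand (suc m)) (weightedSummand (suc m)) Γ) ⟩
    negP (T +P W) ∎
    where open SetoidReasoning ≃-setoid

  total-suc : total (suc m) ≃ shiftP W +P c
  total-suc = begin
    total (suc m)
      ≡⟨ sumP-map-compositions⁺-suc (summand (suc (suc m))) m ⟩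
    sumP (map (summand (suc (suc m)) ∘ (1 ∷_)) Γ)
      +P sumP (map (summand (suc (suc m)) ∘ incrementHead) Γ)
      ≈⟨ +P-cong sumP-prepended sumP-incremented ⟩
    ((T +P shiftP W) +P c) +P negP T
      ≈⟨ +P-negP-cancel T (shiftP W) c ⟩
    shiftP W +P c ∎
    where open SetoidReasoning ≃-setoid

  weighted-suc : weighted (suc m) ≃ (tMinus1 *P W) +P c
  weighted-suc = begin
    weighted (suc m)
      ≡⟨ sumP-map-compositions⁺-suc (weightedSummand (suc (suc m))) m ⟩
    sumP (map (scaleP (+ 1) ∘ summand (suc (suc m)) ∘ (1 ∷_)) Γ) +P incremented
      ≡⟨ cong (_+P incremented) (trans (sumP-map-scaleP (+ 1) _ Γ) (scaleP-one _)) ⟩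
    sumP (map (summand (suc (suc m)) ∘ (1 ∷_)) Γ) +P incremented
      ≈⟨ +P-cong sumP-prepended sumP-incremented-weighted ⟩
    ((T +P shiftP W) +P c) +P negP (T +P W)
      ≈⟨ +P-negP-cancel-+P T (shiftP W) c W ⟩
    (negP W +P shiftP W) +P c
      ≈⟨ +P-cong (tMinus1-*P W) (≃-refl {c}) ⟨
    (tMinus1 *P W) +P c ∎
    where
    open SetoidReasoning ≃-setoid
    incremented = sumP (map (weightedSummand (suc (suc m)) ∘ incrementHead) Γ)

total-step : ∀ m → total (suc (suc m)) ≃ tMinus1 *P total (suc m)
total-step m = begin
  total (suc (suc m))
    ≈⟨ total-suc (suc m) ⟩
  shiftP (weighted (suc m)) +P constP (- s)
    ≈⟨ +P-cong (shiftP-cong (weighted-suc m)) (≃-refl {constP (- s)}) ⟩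
  shiftP ((tMinus1 *P W) +P constP s) +P constP (- s)
    ≡⟨ +P-assoc (shiftP (tMinus1 *P W)) (shiftP (constP s)) (constP (- s)) ⟩
  shiftP (tMinus1 *P W) +P (shiftP (constP s) +P constP (- s))
    ≈⟨ +P-cong (shiftP-*P tMinus1 W) (shiftP-constP-+P-constP s) ⟩
  (tMinus1 *P shiftP W) +P (tMinus1 *P constP s)
    ≈⟨ *P-distribˡ-+P tMinus1 (shiftP W) (constP s) ⟨
  tMinus1 *P (shiftP W +P constP s)
    ≈⟨ *P-congˡ tMinus1 (total-suc m) ⟨
  tMinus1 *P total (suc m) ∎
  where
  open SetoidReasoning ≃-setoid
  s = sign m
  W = weighted m

total-closed : ∀ m → total (suc m) ≃ tMinus1 ^P m
total-closed zero    = ≃-refl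
total-closed (suc m) = ≃-trans (total-step m) (*P-congˡ tMinus1 (total-closed m))

lemma6p5 : (n : ℕ) → 2 ≤ n → (cs : List (List ℕ)) → EnumeratesCompositions n cs →
    (tMinus1 ^P (n ∸ 2)) ≈P rhs n cs
lemma6p5 n@(suc (suc m)) (s≤s (s≤s z≤n)) cs cs-enumerates = _≃_.coeff-≡ (begin
  tMinus1 ^P m  ≈⟨ total-closed m ⟨
  total (suc m) ≡⟨ rhs≡sumP-map-summand n Γ ⟨
  rhs n Γ       ≡⟨ rhs-↭ n (enumerations-↭ (compositions⁺-enumerates (suc m)) cs-enumerates) ⟩
  rhs n cs      ∎)
  where
  open SetoidReasoning ≃-setoid
  Γ = compositions⁺ (suc m)
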